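{- Let $\mathcal Q$ be the set of graphs on $n$ vertices containing no induced subgraph with $4$ vertices and $3$ edges. Then $$\left\lfloor\frac{n^2-5n}{4}\right\rfloor\le\mathrm{Dist}(n,\mathcal Q)\le\frac{n^2-n}{4}.$$
   Context: An edge-operation is the deletion of an existing edge or the addition of a non-existing edge. For an $n$-vertex graph $G$ and a family $\mathcal H$ of $n$-vertex graphs, $\mathrm{Dist}(G,\mathcal H)$ is the minimum of $|E(G)\,\Delta\,E(G')|$ over graphs $G'$ on vertex set $V(G)$ isomorphic to a member of $\mathcal H$, and $\mathrm{Dist}(n,\mathcal H)=\max\{\mathrm{Dist}(G,\mathcal H):|V(G)|=n\}$. -}

module Defs where

open import Data.Nat using (ℕ; _+_; _<?_)
open import Data.Bool using (Bool; true; false; if_then_else_; _xor_)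
open import Data.Fin using (Fin; toℕ)
open import Data.Nat.ListAction using (sum)
open import Data.List using (List; map; filter; allFin; cartesianProduct)
open import Data.Product using (_×_; _,_; Σ; proj₁; proj₂)
open import Relation.Binary.PropositionalEquality using (_≡_)
open import Relation.Nullary using (¬_)
open import Function.Definitions using (Injective)

record Graph (n : ℕ) : Set where
  field
    adj    : Fin n → Fin n → Bool
    sym    : ∀ i j → adj i j ≡ adj j i
    irrefl : ∀ i → adj i i ≡ false
open Graph public

pairs : (n : ℕ) → List (Fin n × Fin n)
pairs n = filter (λ p → toℕ (proj₁ p) <? toℕ (proj₂ p)) (cartesianProduct (allFin n) (allFin n))

count : Bool → ℕ
count true  = 1
count false = 0

edgeCount : ∀ {n} → Graph n → ℕ
edgeCount {n} G = sum (map (λ p → count (adj G (proj₁ p) (proj₂ p))) (pairs n))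

symDiff : ∀ {n} → Graph n → Graph n → ℕ
symDiff {n} G H =
  sum (map (λ p → count (adj G (proj₁ p) (proj₂ p) xor adj H (proj₁ p) (proj₂ p))) (pairs n))

induced : ∀ {k n} → Graph n → (f : Fin k → Fin n) → Injective _≡_ _≡_ f → Graph k
induced G f inj = record
  { adj    = λ i j → adj G (f i) (f j)
  ; sym    = λ i j → sym G (f i) (f j)
  ; irrefl = λ i → irrefl G (f i)
  }

Has43 : ∀ {n} → Graph n → Set
Has43 {n} G = Σ (Fin 4 → Fin n) λ f → Σ (Injective _≡_ _≡_ f) λ inj → edgeCount (induced G f inj) ≡ 3

InQ : ∀ {n} → Graph n → Set
InQ G = ¬ Has43 G

{-# OPTIONS --safe #-}
module Submission where

-- Four vertices span exactly three edges iff they span exactly three non-edges, so 𝒬 is closed under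
-- complementation; excluding induced P₄'s, claws and co-claws on a few four-vertex sets shows that no graph in 𝒬
-- has both a vertex with three neighbours and a vertex with three non-neighbours.  Hence a graph in 𝒬 or its complement has maximum degree at
-- most 2, and so at most n edges.  A graph with ⌊n(n−1)/4⌋ edges and ⌈n(n−1)/4⌉ non-edges is therefore at
-- distance at least (n² − 5n − 2)/4 from 𝒬.  Conversely, the distances from any graph to the empty and to the
-- complete graph, both in 𝒬, add up to n(n−1)/2, so one of them is at most (n² − n)/4.

open import Defs hiding (sym)
open import Data.Nat using (ℕ; zero; suc; _+_; _*_; _∸_; _/_; _≤_; _≤?_; _<?_; _<ᵇ_; z≤n; s≤s; s≤s⁻¹)
open import Data.Nat.Properties
  using ( +-identityʳ; +-comm; +-assoc; *-comm; *-zeroʳ; *-identityʳ; n≮n; ≤-refl; ≤-reflexive; ≤-trans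
        ; <⇒≤; ≮⇒≥; ≰⇒>; m≤m+n; m≤n⇒m≤1+n; m≤n+o⇒m∸n≤o; m+n∸n≡m; +-cancelˡ-≡; *-cancelˡ-≡; *-cancelˡ-≤
        ; +-mono-≤; +-monoˡ-≤; +-monoʳ-≤; +-monoʳ-<; *-monoʳ-≤
        ; +-commutativeSemigroup; +-0-commutativeMonoid; module ≤-Reasoning )
open import Data.Nat.DivMod using (m<n*o⇒m/o<n)
open import Data.Nat.ListAction using (sum)
open import Data.Nat.ListAction.Properties using (sum-++)
open import Data.Nat.Tactic.RingSolver using (solve-∀)
open import Algebra.Properties.CommutativeMonoid.Sum +-0-commutativeMonoid
  using (sum-syntax; ∑-distrib-+; ∑-comm; sum-cong-≗)
open import Algebra.Properties.CommutativeSemigroup +-commutativeSemigroup using (interchange)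
open import Data.Bool using (Bool; true; false; not; _∧_; _xor_; if_then_else_; T)
open import Data.Bool.Properties using (∧-zeroʳ; xor-identityʳ; ¬-not; not-injective; T-≡)
open import Data.Empty using (⊥; ⊥-elim)
open import Data.Fin using (Fin; zero; suc; toℕ)
open import Data.Fin.Properties using (_≟_; <-cmp; all?; ¬∀⟶∃¬)
open import Data.List using (List; []; _∷_; _++_; map; filter; filterᵇ; allFin; cartesianProduct; tabulate; length)
open import Data.List.Properties using (map-++; map-∘; map-cong; map-tabulate)
open import Data.List.Relation.Unary.All using (All; []; _∷_)
open import Data.List.Relation.Unary.All.Properties using (all-filter)
open import Data.List.Relation.Unary.AllPairs using ([]; _∷_)
open import Data.List.Relation.Unary.Unique.Propositional using (Unique)
open import Data.List.Relation.Unary.Unique.Propositional.Properties using (filter⁺; allFin⁺)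
open import Data.Vec using ([]; _∷_; lookup)
open import Data.Vec.Relation.Unary.All using ([]; _∷_)
open import Data.Vec.Relation.Unary.AllPairs using ([]; _∷_)
open import Data.Vec.Relation.Unary.Unique.Propositional using () renaming (Unique to UniqueVec)
open import Data.Vec.Relation.Unary.Unique.Propositional.Properties using (lookup-injective)
open import Data.Product using (Σ; Σ-syntax; _×_; _,_; proj₁; proj₂)
open import Data.Sum using (_⊎_; inj₁; inj₂)
open import Function using (_∘_; id; Equivalence)
open import Relation.Binary using (tri<; tri≈; tri>)
open import Relation.Binary.PropositionalEquality
open import Relation.Nullary using (does; yes; no; contradiction)
open import Relation.Nullary.Decidable using (dec-true; dec-false; T?)
open import Relation.Unary using (Decidable)

-- Sums over Fin n and over unordered pairs

∑-mono-≤ : ∀ {n} {f g : Fin n → ℕ} → (∀ i → f i ≤ g i) → ∑[ i < n ] f i ≤ ∑[ i < n ] g i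
∑-mono-≤ {zero}  f≤g = z≤n
∑-mono-≤ {suc n} f≤g = +-mono-≤ (f≤g zero) (∑-mono-≤ (f≤g ∘ suc))

∑-const : ∀ n c → ∑[ i < n ] c ≡ n * c
∑-const zero    c = refl
∑-const (suc n) c = cong (c +_) (∑-const n c)

module _ {A : Set} where

  sum-map-+ : ∀ (f g : A → ℕ) xs → sum (map (λ x → f x + g x) xs) ≡ sum (map f xs) + sum (map g xs)
  sum-map-+ f g []       = refl
  sum-map-+ f g (x ∷ xs) = trans (cong (f x + g x +_) (sum-map-+ f g xs)) (interchange (f x) (g x) _ _)

  sum-map-mono-≤ : ∀ {f g : A → ℕ} → (∀ x → f x ≤ g x) → ∀ xs → sum (map f xs) ≤ sum (map g xs)
  sum-map-mono-≤ f≤g []       = z≤n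
  sum-map-mono-≤ f≤g (x ∷ xs) = +-mono-≤ (f≤g x) (sum-map-mono-≤ f≤g xs)

  sum-map-filter : ∀ {P : A → Set} (P? : Decidable P) (f : A → ℕ) xs →
    sum (map f (filter P? xs)) ≡ sum (map (λ x → if does (P? x) then f x else 0) xs)
  sum-map-filter P? f []       = refl
  sum-map-filter P? f (x ∷ xs) with does (P? x)
  ... | true  = cong (f x +_) (sum-map-filter P? f xs)
  ... | false = sum-map-filter P? f xs

  length-filterᵇ : ∀ (P : A → Bool) xs → length (filterᵇ P xs) ≡ sum (map (λ x → count (P x)) xs)
  length-filterᵇ P []       = refl
  length-filterᵇ P (x ∷ xs) with P x
  ... | true  = cong suc (length-filterᵇ P xs)
  ... | false = length-filterᵇ P xs

sum-map-cartesianProduct : ∀ {A B : Set} (f : A × B → ℕ) xs ys →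
  sum (map f (cartesianProduct xs ys)) ≡ sum (map (λ x → sum (map (λ y → f (x , y)) ys)) xs)
sum-map-cartesianProduct f []       ys = refl
sum-map-cartesianProduct f (x ∷ xs) ys = begin
  sum (map f (map (x ,_) ys ++ cartesianProduct xs ys))
    ≡⟨ cong sum (map-++ f (map (x ,_) ys) _) ⟩
  sum (map f (map (x ,_) ys) ++ map f (cartesianProduct xs ys))
    ≡⟨ sum-++ (map f (map (x ,_) ys)) _ ⟩
  sum (map f (map (x ,_) ys)) + sum (map f (cartesianProduct xs ys))
    ≡⟨ cong₂ _+_ (cong sum (sym (map-∘ ys))) (sum-map-cartesianProduct f xs ys) ⟩
  sum (map (λ y → f (x , y)) ys) + sum (map (λ x → sum (map (λ y → f (x , y)) ys)) xs) ∎
  where open ≡-Reasoning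

sum-tabulate : ∀ {n} (f : Fin n → ℕ) → sum (tabulate f) ≡ ∑[ i < n ] f i
sum-tabulate {zero}  f = refl
sum-tabulate {suc n} f = cong (f zero +_) (sum-tabulate (f ∘ suc))

sum-map-allFin : ∀ {n} (f : Fin n → ℕ) → sum (map f (allFin n)) ≡ ∑[ i < n ] f i
sum-map-allFin f = trans (cong sum (map-tabulate id f)) (sum-tabulate f)

below : ∀ {n} → Fin n → Fin n → ℕ → ℕ
below i j x = if does (toℕ i <? toℕ j) then x else 0

sum-pairs : ∀ {n} (f : Fin n → Fin n → ℕ) →
  sum (map (λ p → f (proj₁ p) (proj₂ p)) (pairs n)) ≡ ∑[ i < n ] ∑[ j < n ] below i j (f i j)
sum-pairs {n} f = begin
  sum (map (λ p → f (proj₁ p) (proj₂ p)) (pairs n))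
    ≡⟨ sum-map-filter (λ p → toℕ (proj₁ p) <? toℕ (proj₂ p)) (λ p → f (proj₁ p) (proj₂ p)) all-pairs ⟩
  sum (map (λ p → below (proj₁ p) (proj₂ p) (f (proj₁ p) (proj₂ p))) all-pairs)
    ≡⟨ sum-map-cartesianProduct (λ p → below (proj₁ p) (proj₂ p) (f (proj₁ p) (proj₂ p))) (allFin n) (allFin n) ⟩
  sum (map (λ i → sum (map (λ j → below i j (f i j)) (allFin n))) (allFin n))
    ≡⟨ sum-map-allFin (λ i → sum (map (λ j → below i j (f i j)) (allFin n))) ⟩
  ∑[ i < n ] sum (map (λ j → below i j (f i j)) (allFin n))
    ≡⟨ sum-cong-≗ (λ i → sum-map-allFin (λ j → below i j (f i j))) ⟩
  ∑[ i < n ] ∑[ j < n ] below i j (f i j) ∎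
  where
  open ≡-Reasoning
  all-pairs = cartesianProduct (allFin n) (allFin n)

below-split : ∀ {n} (f : Fin n → Fin n → ℕ) → (∀ i → f i i ≡ 0) →
  ∀ i j → f i j ≡ below i j (f i j) + below j i (f i j)
below-split f diag i j with <-cmp i j
... | tri< i<j _ j≮i rewrite dec-true (toℕ i <? toℕ j) i<j | dec-false (toℕ j <? toℕ i) j≮i = sym (+-identityʳ _)
... | tri≈ _ refl _  rewrite diag i | dec-false (toℕ i <? toℕ i) (n≮n (toℕ i)) = refl
... | tri> i≮j _ j<i rewrite dec-false (toℕ i <? toℕ j) i≮j | dec-true (toℕ j <? toℕ i) j<i = refl

twice-sum-pairs : ∀ {n} (f : Fin n → Fin n → ℕ) → (∀ i j → f i j ≡ f j i) → (∀ i → f i i ≡ 0) →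
  2 * sum (map (λ p → f (proj₁ p) (proj₂ p)) (pairs n)) ≡ ∑[ i < n ] ∑[ j < n ] f i j
twice-sum-pairs {n} f f-sym diag = begin
  2 * sum (map (λ p → f (proj₁ p) (proj₂ p)) (pairs n))
    ≡⟨ cong (2 *_) (sum-pairs f) ⟩
  2 * upper
    ≡⟨ cong (upper +_) (+-identityʳ upper) ⟩
  upper + upper
    ≡⟨ cong (upper +_) (trans (∑-comm (λ i j → below i j (f i j)))
                              (sum-cong-≗ λ i → sum-cong-≗ λ j → cong (below j i) (f-sym j i))) ⟩
  upper + ∑[ i < n ] ∑[ j < n ] below j i (f i j)
    ≡⟨ ∑-distrib-+ (λ i → ∑[ j < n ] below i j (f i j)) (λ i → ∑[ j < n ] below j i (f i j)) ⟨
  ∑[ i < n ] (∑[ j < n ] below i j (f i j) + ∑[ j < n ] below j i (f i j))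
    ≡⟨ sum-cong-≗ (λ i → ∑-distrib-+ (λ j → below i j (f i j)) (λ j → below j i (f i j))) ⟨
  ∑[ i < n ] ∑[ j < n ] (below i j (f i j) + below j i (f i j))
    ≡⟨ sum-cong-≗ (λ i → sum-cong-≗ λ j → below-split f diag i j) ⟨
  ∑[ i < n ] ∑[ j < n ] f i j ∎
  where
  open ≡-Reasoning
  upper = ∑[ i < n ] ∑[ j < n ] below i j (f i j)

-- Degrees, complements and edge counts

degree : ∀ {n} → Graph n → Fin n → ℕ
degree {n} G i = ∑[ j < n ] count (adj G i j)

handshake : ∀ {n} (G : Graph n) → 2 * edgeCount G ≡ ∑[ i < n ] degree G i
handshake G =
  twice-sum-pairs (λ i j → count (adj G i j)) (λ i j → cong count (Graph.sym G i j)) (λ i → cong count (irrefl G i))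

≟-sym : ∀ {n} (i j : Fin n) → does (i ≟ j) ≡ does (j ≟ i)
≟-sym i j with i ≟ j
... | yes refl = sym (dec-true (i ≟ i) refl)
... | no i≢j   = sym (dec-false (j ≟ i) (≢-sym i≢j))

complement : ∀ {n} → Graph n → Graph n
complement G = record
  { adj    = λ i j → not (adj G i j) ∧ not (does (i ≟ j))
  ; sym    = λ i j → cong₂ (λ a d → not a ∧ not d) (Graph.sym G i j) (≟-sym i j)
  ; irrefl = λ i → trans (cong (λ d → not (adj G i i) ∧ not d) (dec-true (i ≟ i) refl)) (∧-zeroʳ _)
  }

empty : ∀ n → Graph n
empty n = record { adj = λ _ _ → false ; sym = λ _ _ → refl ; irrefl = λ _ → refl }

complete : ∀ n → Graph n
complete n = complement (empty n)

count-not : ∀ b → count (not b) + count b ≡ 1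
count-not true  = refl
count-not false = refl

∑-≟ : ∀ {n} (i : Fin n) → ∑[ j < n ] count (does (i ≟ j)) ≡ 1
∑-≟ {suc n} zero    = cong suc (trans (∑-const n 0) (*-zeroʳ n))
∑-≟ {suc n} (suc i) = ∑-≟ i

degree-complete : ∀ {n} (i : Fin n) → degree (complete n) i + 1 ≡ n
degree-complete {n} i = begin
  ∑[ j < n ] count (not (does (i ≟ j))) + 1
    ≡⟨ cong (∑[ j < n ] count (not (does (i ≟ j))) +_) (∑-≟ i) ⟨
  ∑[ j < n ] count (not (does (i ≟ j))) + ∑[ j < n ] count (does (i ≟ j))
    ≡⟨ ∑-distrib-+ (λ j → count (not (does (i ≟ j)))) (λ j → count (does (i ≟ j))) ⟨
  ∑[ j < n ] (count (not (does (i ≟ j))) + count (does (i ≟ j)))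
    ≡⟨ sum-cong-≗ (λ j → count-not (does (i ≟ j))) ⟩
  ∑[ j < n ] 1
    ≡⟨ trans (∑-const n 1) (*-identityʳ n) ⟩
  n ∎
  where open ≡-Reasoning

edgeCount-complete : ∀ n → 2 * edgeCount (complete n) + n ≡ n * n
edgeCount-complete n = begin
  2 * edgeCount (complete n) + n
    ≡⟨ cong₂ _+_ (handshake (complete n)) (sym (trans (∑-const n 1) (*-identityʳ n))) ⟩
  ∑[ i < n ] degree (complete n) i + ∑[ i < n ] 1
    ≡⟨ ∑-distrib-+ (degree (complete n)) (λ _ → 1) ⟨
  ∑[ i < n ] (degree (complete n) i + 1)
    ≡⟨ sum-cong-≗ (degree-complete {n}) ⟩
  ∑[ i < n ] n
    ≡⟨ ∑-const n n ⟩
  n * n ∎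
  where open ≡-Reasoning

edgeCount-complement : ∀ {n} (G : Graph n) → edgeCount G + edgeCount (complement G) ≡ edgeCount (complete n)
edgeCount-complement {n} G =
  trans (sym (sum-map-+ (edge G) (edge (complement G)) (pairs n)))
        (cong sum (map-cong (λ p → pointwise (proj₁ p) (proj₂ p)) (pairs n)))
  where
  edge : Graph n → Fin n × Fin n → ℕ
  edge H p = count (adj H (proj₁ p) (proj₂ p))
  pointwise : ∀ i j → count (adj G i j) + count (adj (complement G) i j) ≡ count (adj (complete n) i j)
  pointwise i j with i ≟ j
  ... | yes refl rewrite irrefl G i = refl
  ... | no _ with adj G i j
  ...   | true  = refl
  ...   | false = refl

symDiff-empty : ∀ {n} (G : Graph n) → symDiff G (empty n) ≡ edgeCount G
symDiff-empty {n} G = cong sum (map-cong (λ p → cong count (xor-identityʳ (adj G (proj₁ p) (proj₂ p)))) (pairs n))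

symDiff-complete : ∀ {n} (G : Graph n) → symDiff G (complete n) ≡ edgeCount (complement G)
symDiff-complete {n} G = cong sum (map-cong (λ p → cong count (pointwise (proj₁ p) (proj₂ p))) (pairs n))
  where
  pointwise : ∀ i j → adj G i j xor adj (complete n) i j ≡ adj (complement G) i j
  pointwise i j with i ≟ j
  ... | yes refl rewrite irrefl G i = refl
  ... | no _ with adj G i j
  ...   | true  = refl
  ...   | false = refl

symDiff-empty+complete : ∀ {n} (G : Graph n) → symDiff G (empty n) + symDiff G (complete n) ≡ edgeCount (complete n)
symDiff-empty+complete G = trans (cong₂ _+_ (symDiff-empty G) (symDiff-complete G)) (edgeCount-complement G)

symDiff-complement : ∀ {n} (G H : Graph n) → symDiff (complement G) (complement H) ≡ symDiff G H
symDiff-complement {n} G H = cong sum (map-cong (λ p → cong count (pointwise (proj₁ p) (proj₂ p))) (pairs n))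
  where
  pointwise : ∀ i j → adj (complement G) i j xor adj (complement H) i j ≡ adj G i j xor adj H i j
  pointwise i j with i ≟ j
  ... | yes refl rewrite irrefl G i | irrefl H i = refl
  ... | no _ with adj G i j | adj H i j
  ...   | true  | true  = refl
  ...   | true  | false = refl
  ...   | false | true  = refl
  ...   | false | false = refl

edgeCount≤symDiff+edgeCount : ∀ {n} (G H : Graph n) → edgeCount G ≤ symDiff G H + edgeCount H
edgeCount≤symDiff+edgeCount {n} G H =
  ≤-trans (sum-map-mono-≤ (λ p → pointwise (adj G (proj₁ p) (proj₂ p)) (adj H (proj₁ p) (proj₂ p))) (pairs n))
          (≤-reflexive (sum-map-+ (λ p → count (adj G (proj₁ p) (proj₂ p) xor adj H (proj₁ p) (proj₂ p)))
                                  (λ p → count (adj H (proj₁ p) (proj₂ p))) (pairs n)))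
  where
  pointwise : ∀ a b → count a ≤ count (a xor b) + count b
  pointwise true  true  = s≤s z≤n
  pointwise true  false = s≤s z≤n
  pointwise false _     = z≤n

degree≤2⇒edgeCount≤n : ∀ {n} (G : Graph n) → (∀ i → degree G i ≤ 2) → edgeCount G ≤ n
degree≤2⇒edgeCount≤n {n} G Δ≤2 = *-cancelˡ-≤ 2 (begin
  2 * edgeCount G          ≡⟨ handshake G ⟩
  ∑[ i < n ] degree G i    ≤⟨ ∑-mono-≤ Δ≤2 ⟩
  ∑[ i < n ] 2             ≡⟨ trans (∑-const n 2) (*-comm n 2) ⟩
  2 * n                    ∎)
  where open ≤-Reasoning

degree≤2⇒edgeCount≤symDiff+n : ∀ {n} (G H : Graph n) → (∀ i → degree H i ≤ 2) → edgeCount G ≤ symDiff G H + n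
degree≤2⇒edgeCount≤symDiff+n G H Δ≤2 =
  ≤-trans (edgeCount≤symDiff+edgeCount G H) (+-monoʳ-≤ (symDiff G H) (degree≤2⇒edgeCount≤n H Δ≤2))

-- Four-vertex configurations

count-not-sum : ∀ bs → sum (map count (map not bs)) + sum (map count bs) ≡ length bs
count-not-sum []       = refl
count-not-sum (b ∷ bs) =
  trans (interchange (count (not b)) _ (count b) _) (cong₂ _+_ (count-not b) (count-not-sum bs))

adjacencies4 : ∀ {n} → (Fin n → Fin n → Bool) → Fin n → Fin n → Fin n → Fin n → List Bool
adjacencies4 A p q r s = A p q ∷ A p r ∷ A p s ∷ A q r ∷ A q s ∷ A r s ∷ []

edges4 : ∀ {n} → (Fin n → Fin n → Bool) → Fin n → Fin n → Fin n → Fin n → ℕ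
edges4 A p q r s = sum (map count (adjacencies4 A p q r s))

-- Stated for an arbitrary Boolean relation, which need not be irreflexive, so that it is inherited by the
-- pointwise negation of the adjacency relation.
No43 : ∀ {n} → (Fin n → Fin n → Bool) → Set
No43 A = ∀ {p q r s} → p ≢ q → p ≢ r → p ≢ s → q ≢ r → q ≢ s → r ≢ s → edges4 A p q r s ≢ 3

InQ⇒No43 : ∀ {n} (G : Graph n) → InQ G → No43 (adj G)
InQ⇒No43 G G∈Q {p} {q} {r} {s} p≢q p≢r p≢s q≢r q≢s r≢s three-edges =
  G∈Q (lookup vertices , (λ {i} {j} → lookup-injective distinct i j) , three-edges)
  where
  vertices = p ∷ q ∷ r ∷ s ∷ []
  distinct : UniqueVec vertices
  distinct = (p≢q ∷ p≢r ∷ p≢s ∷ []) ∷ (q≢r ∷ q≢s ∷ []) ∷ (r≢s ∷ []) ∷ [] ∷ []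

No43-complement : ∀ {n} {A : Fin n → Fin n → Bool} → No43 A → No43 (λ i j → not (A i j))
No43-complement {A = A} no43 {p} {q} {r} {s} p≢q p≢r p≢s q≢r q≢s r≢s three-non-edges =
  no43 p≢q p≢r p≢s q≢r q≢s r≢s (+-cancelˡ-≡ 3 _ 3 (begin
    3 + edges4 A p q r s                                     ≡⟨ cong (_+ edges4 A p q r s) three-non-edges ⟨
    edges4 (λ i j → not (A i j)) p q r s + edges4 A p q r s  ≡⟨ count-not-sum (adjacencies4 A p q r s) ⟩
    6                                                        ∎))
  where open ≡-Reasoning

Adj : ∀ {n} → (Fin n → Fin n → Bool) → Bool → Fin n → Fin n → Set
Adj A b v x = x ≢ v × A v x ≡ b

record Three {A : Set} (P : A → Set) : Set where
  constructor three
  field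
    a b c : A
    a≢b   : a ≢ b
    a≢c   : a ≢ c
    b≢c   : b ≢ c
    Pa    : P a
    Pb    : P b
    Pc    : P c

Three-map : ∀ {A : Set} {P Q : A → Set} → (∀ {x} → P x → Q x) → Three P → Three Q
Three-map f (three a b c a≢b a≢c b≢c Pa Pb Pc) = three a b c a≢b a≢c b≢c (f Pa) (f Pb) (f Pc)

two-avoiding : ∀ {n} {P : Fin n → Set} (v : Fin n) → Three P →
  Σ[ x ∈ Fin n ] Σ[ y ∈ Fin n ] x ≢ y × (P x × x ≢ v) × (P y × y ≢ v)
two-avoiding v (three a b c a≢b a≢c b≢c Pa Pb Pc) with a ≟ v | b ≟ v
... | yes refl | _        = b , c , b≢c , (Pb , ≢-sym a≢b) , (Pc , ≢-sym a≢c)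
... | no a≢v   | yes refl = a , c , a≢c , (Pa , a≢v) , (Pc , ≢-sym b≢c)
... | no a≢v   | no b≢v   = a , b , a≢b , (Pa , a≢v) , (Pb , b≢v)

module Configurations {n} (A : Fin n → Fin n → Bool) (A-sym : ∀ i j → A i j ≡ A j i) (no43 : No43 A) where

  excluded : ∀ {p q r s} → p ≢ q → p ≢ r → p ≢ s → q ≢ r → q ≢ s → r ≢ s →
             ∀ {b₁ b₂ b₃ b₄ b₅ b₆} → A p q ≡ b₁ → A p r ≡ b₂ → A p s ≡ b₃ → A q r ≡ b₄ → A q s ≡ b₅ → A r s ≡ b₆ →
             sum (map count (b₁ ∷ b₂ ∷ b₃ ∷ b₄ ∷ b₅ ∷ b₆ ∷ [])) ≡ 3 → ⊥
  excluded p≢q p≢r p≢s q≢r q≢s r≢s refl refl refl refl refl refl = no43 p≢q p≢r p≢s q≢r q≢s r≢s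

  forced-true : ∀ {x y} → (A x y ≡ false → ⊥) → A x y ≡ true
  forced-true = ¬-not

  forced-false : ∀ {x y} → (A x y ≡ true → ⊥) → A x y ≡ false
  forced-false = ¬-not

  distinguishes : ∀ {z x y} → A z x ≡ true → A z y ≡ false → x ≢ y
  distinguishes zx zy refl = contradiction (trans (sym zx) zy) λ ()

  triangle-plus-point : ∀ {v x y t} → Adj A true v x → Adj A true v y → x ≢ y → A x y ≡ true →
                        Adj A false v t → A x t ≡ false → A y t ≡ false → ⊥
  triangle-plus-point (x≢v , vx) (y≢v , vy) x≢y xy (t≢v , vt) xt yt =
    excluded (≢-sym x≢v) (≢-sym y≢v) (≢-sym t≢v) x≢y (distinguishes vx vt) (distinguishes vy vt) vx vy vt xy xt yt refl

  claw : ∀ {v} (N : Three (Adj A true v)) → let open Three N in A a b ≡ false → A a c ≡ false → A b c ≡ false → ⊥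
  claw (three a b c a≢b a≢c b≢c (a≢v , va) (b≢v , vb) (c≢v , vc)) ab ac bc =
    excluded (≢-sym a≢v) (≢-sym b≢v) (≢-sym c≢v) a≢b a≢c b≢c va vb vc ab ac bc refl

  non-neighbour-adjacent-to-neighbour : ∀ {v t} → Three (Adj A true v) → Adj A false v t →
                                        Σ[ q ∈ Fin n ] Adj A true v q × A q t ≡ true
  non-neighbour-adjacent-to-neighbour {t = t} N@(three a b c a≢b a≢c b≢c Na Nb Nc) T
    with A a t in at | A b t in bt | A c t in ct
  ... | true  | _     | _     = a , Na , at
  ... | false | true  | _     = b , Nb , bt
  ... | false | false | true  = c , Nc , ct
  ... | false | false | false with A a b in ab | A a c in ac | A b c in bc
  ...   | true  | _     | _     = ⊥-elim (triangle-plus-point Na Nb a≢b ab T at bt)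
  ...   | false | true  | _     = ⊥-elim (triangle-plus-point Na Nc a≢c ac T at ct)
  ...   | false | false | true  = ⊥-elim (triangle-plus-point Nb Nc b≢c bc T bt ct)
  ...   | false | false | false = ⊥-elim (claw N ab ac bc)

  -- Each of s ≁ t, q ≁ s and p ∼ q is forced by a four-set containing v; then s p q t is an induced P₄.
  alternating-path : ∀ {v p q s t} → Adj A true v p → Adj A true v q → Adj A false v s → Adj A false v t →
                     A p s ≡ true → A p t ≡ false → A q t ≡ true → ⊥
  alternating-path (p≢v , vp) (q≢v , vq) (s≢v , vs) (t≢v , vt) ps pt qt =
    excluded p≢q p≢s p≢t q≢s q≢t s≢t pq ps pt qs qt st refl
    where
    p≢s = distinguishes vp vs
    p≢t = distinguishes vp vt
    q≢s = distinguishes vq vs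
    q≢t = distinguishes vq vt
    s≢t = distinguishes ps pt
    p≢q = ≢-sym (distinguishes (trans (A-sym _ _) qt) (trans (A-sym _ _) pt))
    st = forced-false λ st → excluded (≢-sym p≢v) (≢-sym s≢v) (≢-sym t≢v) p≢s p≢t s≢t vp vs vt ps pt st refl
    qs = forced-false λ qs → excluded (≢-sym q≢v) (≢-sym s≢v) (≢-sym t≢v) q≢s q≢t s≢t vq vs vt qs qt st refl
    pq = forced-true λ pq → excluded (≢-sym p≢v) (≢-sym q≢v) (≢-sym t≢v) p≢q p≢t q≢t vp vq vt pq pt qt refl

  no-common-non-neighbour : ∀ {v w t} → Three (Adj A true v) → Adj A false v w → Adj A false v t → Adj A false w t → ⊥
  no-common-non-neighbour N W@(w≢v , vw) T@(t≢v , vt) (t≢w , wt)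
    with non-neighbour-adjacent-to-neighbour N W | non-neighbour-adjacent-to-neighbour N T
  ... | p , P@(p≢v , vp) , pw | q , Q , qt = alternating-path P Q W T pw pt qt
    where
    pt = forced-false λ pt →
      excluded (≢-sym p≢v) (≢-sym w≢v) (≢-sym t≢v) (distinguishes vp vw) (distinguishes vp vt) (≢-sym t≢w)
               vp vw vt pw pt wt refl

  no-non-neighbour-missing-two-neighbours : ∀ {v w t₁ t₂} → Three (Adj A true v) → Adj A false v w →
    Adj A true v t₁ → Adj A true v t₂ → t₁ ≢ t₂ → A w t₁ ≡ false → A w t₂ ≡ false → ⊥
  no-non-neighbour-missing-two-neighbours {v} {w} N W@(w≢v , vw) (t₁≢v , vt₁) (t₂≢v , vt₂) t₁≢t₂ wt₁ wt₂
    with non-neighbour-adjacent-to-neighbour N W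
  ... | p , (p≢v , vp) , pw =
    excluded (≢-sym w≢v) (≢-sym t₁≢v) (≢-sym t₂≢v) w≢t₁ w≢t₂ t₁≢t₂ vw vt₁ vt₂ wt₁ wt₂ t₁t₂ refl
    where
    wp = trans (A-sym w p) pw
    w≢t₁ = ≢-sym (distinguishes vt₁ vw)
    w≢t₂ = ≢-sym (distinguishes vt₂ vw)
    p-adjacent : ∀ {t} → Adj A true v t → A w t ≡ false → A p t ≡ true
    p-adjacent (t≢v , vt) wt = forced-true λ pt →
      excluded (≢-sym p≢v) (≢-sym w≢v) (≢-sym t≢v) (distinguishes vp vw) (distinguishes wp wt) (≢-sym (distinguishes vt vw))
               vp vw vt pw pt wt refl
    t₁t₂ = forced-true λ t₁t₂ →
      excluded (≢-sym (distinguishes vp vw)) w≢t₁ w≢t₂ (distinguishes wp wt₁) (distinguishes wp wt₂) t₁≢t₂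
               wp wt₁ wt₂ (p-adjacent (t₁≢v , vt₁) wt₁) (p-adjacent (t₂≢v , vt₂) wt₂) t₁t₂ refl

  neighbour-or-non-neighbour : ∀ {v x} → x ≢ v → Adj A true v x ⊎ Adj A false v x
  neighbour-or-non-neighbour {v} {x} x≢v with A v x
  ... | true  = inj₁ (x≢v , refl)
  ... | false = inj₂ (x≢v , refl)

  no-three-and-three-at-non-adjacent-vertices : ∀ {v w} → v ≢ w → A v w ≡ false →
    Three (Adj A true v) → Three (Adj A false w) → ⊥
  no-three-and-three-at-non-adjacent-vertices {v} v≢w vw N M with two-avoiding v M
  ... | t₁ , t₂ , t₁≢t₂ , (M₁ , t₁≢v) , (M₂ , t₂≢v) with neighbour-or-non-neighbour t₁≢v | neighbour-or-non-neighbour t₂≢v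
  ...   | inj₂ T₁ | _       = no-common-non-neighbour N (≢-sym v≢w , vw) T₁ M₁
  ...   | inj₁ _  | inj₂ T₂ = no-common-non-neighbour N (≢-sym v≢w , vw) T₂ M₂
  ...   | inj₁ T₁ | inj₁ T₂ =
    no-non-neighbour-missing-two-neighbours N (≢-sym v≢w , vw) T₁ T₂ t₁≢t₂ (proj₂ M₁) (proj₂ M₂)

module _ {n} {A : Fin n → Fin n → Bool} (A-sym : ∀ i j → A i j ≡ A j i) (no43 : No43 A) where

  private
    Aᶜ : Fin n → Fin n → Bool
    Aᶜ i j = not (A i j)

    to-complement : ∀ {b v x} → Adj A b v x → Adj Aᶜ (not b) v x
    to-complement (x≢v , vx) = x≢v , cong not vx

    from-complement : ∀ {v x} → Adj Aᶜ true v x → Adj A false v x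
    from-complement (x≢v , vx) = x≢v , not-injective vx

    module C  = Configurations A A-sym no43
    module Cᶜ = Configurations Aᶜ (λ i j → cong not (A-sym i j)) (No43-complement {A = A} no43)

  -- s has a neighbour p among those of v; read in the complement, p has a non-neighbour t among the
  -- non-neighbours of v; t has a neighbour q among those of v.
  no-three-and-three-at-one-vertex : ∀ {v} → Three (Adj A true v) → Three (Adj A false v) → ⊥
  no-three-and-three-at-one-vertex N M@(three s _ _ _ _ _ S _ _)
    with C.non-neighbour-adjacent-to-neighbour N S
  ... | p , P , ps with Cᶜ.non-neighbour-adjacent-to-neighbour (Three-map to-complement M) (to-complement P)
  ...   | t , T , tp with C.non-neighbour-adjacent-to-neighbour N (from-complement T)
  ...     | q , Q , qt = C.alternating-path P Q S (from-complement T) ps (trans (A-sym p t) (not-injective tp)) qt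

  -- For adjacent v and w, pass to the complement, where they are non-adjacent with their roles exchanged.
  no-three-neighbours-and-three-non-neighbours : ∀ {v w} → Three (Adj A true v) → Three (Adj A false w) → ⊥
  no-three-neighbours-and-three-non-neighbours {v} {w} N M with v ≟ w
  ... | yes refl = no-three-and-three-at-one-vertex N M
  ... | no v≢w with A v w in vw
  ...   | false = C.no-three-and-three-at-non-adjacent-vertices v≢w vw N M
  ...   | true  = Cᶜ.no-three-and-three-at-non-adjacent-vertices (≢-sym v≢w) (cong not (trans (A-sym w v) vw))
                    (Three-map to-complement M) (Three-map to-complement N)

three-of-unique : ∀ {A : Set} {P : A → Set} {xs : List A} → Unique xs → All P xs → 3 ≤ length xs → Three P
three-of-unique {xs = []}         _ _ ()
three-of-unique {xs = _ ∷ []}     _ _ (s≤s ())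
three-of-unique {xs = _ ∷ _ ∷ []} _ _ (s≤s (s≤s ()))
three-of-unique {xs = a ∷ b ∷ c ∷ _} ((a≢b ∷ a≢c ∷ _) ∷ (b≢c ∷ _) ∷ _) (Pa ∷ Pb ∷ Pc ∷ _) _ =
  three a b c a≢b a≢c b≢c Pa Pb Pc

three-witnesses : ∀ {n} (P : Fin n → Bool) → 3 ≤ ∑[ i < n ] count (P i) → Three (λ i → T (P i))
three-witnesses {n} P 3≤count =
  three-of-unique (filter⁺ (T? ∘ P) (allFin⁺ n)) (all-filter (T? ∘ P) (allFin n))
    (subst (3 ≤_) (sym (trans (length-filterᵇ P (allFin n)) (sum-map-allFin (λ i → count (P i))))) 3≤count)

neighbour : ∀ {n} (G : Graph n) {v x} → T (adj G v x) → Adj (adj G) true v x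
neighbour G {v} vx = (λ { refl → subst T (irrefl G v) vx }) , Equivalence.to T-≡ vx

non-neighbour : ∀ {n} (G : Graph n) {w x} → T (adj (complement G) w x) → Adj (adj G) false w x
non-neighbour G {w} {x} wx with adj G w x | w ≟ x
... | true  | _        = ⊥-elim wx
... | false | yes refl = ⊥-elim wx
... | false | no w≢x   = ≢-sym w≢x , refl

degree-dichotomy : ∀ {n} (G : Graph n) → InQ G → (∀ i → degree G i ≤ 2) ⊎ (∀ i → degree (complement G) i ≤ 2)
degree-dichotomy {n} G G∈Q with all? (λ i → degree G i ≤? 2)
... | yes Δ≤2 = inj₁ Δ≤2
... | no ¬Δ≤2 with ¬∀⟶∃¬ n _ (λ i → degree G i ≤? 2) ¬Δ≤2
...   | v , degree≰2 = inj₂ λ w → ≮⇒≥ λ 3≤codegree →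
  no-three-neighbours-and-three-non-neighbours (Graph.sym G) (InQ⇒No43 G G∈Q)
    (Three-map (neighbour G) (three-witnesses (adj G v) (≰⇒> degree≰2)))
    (Three-map (non-neighbour G) (three-witnesses (adj (complement G) w) 3≤codegree))

-- A balanced threshold graph

new-degree : ℕ → ℕ
new-degree 0 = 0
new-degree 1 = 0
new-degree 2 = 1
new-degree 3 = 2
new-degree (suc (suc (suc (suc n)))) = 2 + new-degree n

defect : ℕ → ℕ
defect 0 = 0
defect 1 = 0
defect 2 = 2
defect 3 = 2
defect (suc (suc (suc (suc n)))) = defect n

new-degree≤ : ∀ n → new-degree n ≤ n
new-degree≤ 0 = z≤n
new-degree≤ 1 = z≤n
new-degree≤ 2 = s≤s z≤n
new-degree≤ 3 = s≤s (s≤s z≤n)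
new-degree≤ (suc (suc (suc (suc n)))) = s≤s (s≤s (m≤n⇒m≤1+n (m≤n⇒m≤1+n (new-degree≤ n))))

defect≤2 : ∀ n → defect n ≤ 2
defect≤2 0 = z≤n
defect≤2 1 = z≤n
defect≤2 2 = ≤-refl
defect≤2 3 = ≤-refl
defect≤2 (suc (suc (suc (suc n)))) = defect≤2 n

new-degree-defect : ∀ n → 4 * new-degree n + defect (suc n) ≡ defect n + 2 * n
new-degree-defect 0 = refl
new-degree-defect 1 = refl
new-degree-defect 2 = refl
new-degree-defect 3 = refl
new-degree-defect (suc (suc (suc (suc n)))) = begin
  4 * (2 + new-degree n) + defect (suc n)   ≡⟨ shift (new-degree n) (defect (suc n)) ⟩
  8 + (4 * new-degree n + defect (suc n))   ≡⟨ cong (8 +_) (new-degree-defect n) ⟩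
  8 + (defect n + 2 * n)                    ≡⟨ unshift (defect n) n ⟩
  defect n + 2 * (4 + n)                    ∎
  where
  open ≡-Reasoning
  shift : ∀ k d → 4 * (2 + k) + d ≡ 8 + (4 * k + d)
  shift = solve-∀
  unshift : ∀ d m → 8 + (d + 2 * m) ≡ d + 2 * (4 + m)
  unshift = solve-∀

edges₀ : ℕ → ℕ
edges₀ zero    = 0
edges₀ (suc n) = new-degree n + edges₀ n

-- edges₀ n = ⌊n(n − 1)/4⌋, with remainder defect n ∈ {0, 2}.
edges₀-invariant : ∀ n → 4 * edges₀ n + defect n + n ≡ n * n
edges₀-invariant zero    = refl
edges₀-invariant (suc n) = begin
  4 * (k + e) + defect (suc n) + suc n     ≡⟨ regroup k e (defect (suc n)) n ⟩
  (4 * k + defect (suc n)) + 4 * e + suc n ≡⟨ cong (λ x → x + 4 * e + suc n) (new-degree-defect n) ⟩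
  (defect n + 2 * n) + 4 * e + suc n       ≡⟨ regroup′ e (defect n) n ⟩
  (4 * e + defect n + n) + (2 * n + 1)     ≡⟨ cong (_+ (2 * n + 1)) (edges₀-invariant n) ⟩
  n * n + (2 * n + 1)                      ≡⟨ square n ⟩
  suc n * suc n                            ∎
  where
  open ≡-Reasoning
  k = new-degree n
  e = edges₀ n
  regroup : ∀ k e d n → 4 * (k + e) + d + suc n ≡ (4 * k + d) + 4 * e + suc n
  regroup = solve-∀
  regroup′ : ∀ e d n → (d + 2 * n) + 4 * e + suc n ≡ (4 * e + d + n) + (2 * n + 1)
  regroup′ = solve-∀
  square : ∀ n → n * n + (2 * n + 1) ≡ suc n * suc n
  square = solve-∀

-- Vertex zero of Fin (suc n) is joined to the first new-degree n of the other vertices, which alternates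
-- between ⌊n/2⌋ and ⌈n/2⌉ so as to keep the invariant above.
balanced-adj : ∀ n → Fin n → Fin n → Bool
balanced-adj (suc n) zero    zero    = false
balanced-adj (suc n) zero    (suc j) = toℕ j <ᵇ new-degree n
balanced-adj (suc n) (suc i) zero    = toℕ i <ᵇ new-degree n
balanced-adj (suc n) (suc i) (suc j) = balanced-adj n i j

balanced : ∀ n → Graph n
balanced n = record { adj = balanced-adj n ; sym = adj-sym n ; irrefl = adj-irrefl n }
  where
  adj-sym : ∀ n i j → balanced-adj n i j ≡ balanced-adj n j i
  adj-sym (suc n) zero    zero    = refl
  adj-sym (suc n) zero    (suc j) = refl
  adj-sym (suc n) (suc i) zero    = refl
  adj-sym (suc n) (suc i) (suc j) = adj-sym n i j
  adj-irrefl : ∀ n i → balanced-adj n i i ≡ false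
  adj-irrefl (suc n) zero    = refl
  adj-irrefl (suc n) (suc i) = adj-irrefl n i

∑-below : ∀ {n k} → k ≤ n → ∑[ j < n ] count (toℕ j <ᵇ k) ≡ k
∑-below {n}     {zero}  _         = trans (∑-const n 0) (*-zeroʳ n)
∑-below {suc n} {suc k} (s≤s k≤n) = cong suc (∑-below k≤n)

degree-sum-balanced : ∀ n → ∑[ i < n ] degree (balanced n) i ≡ 2 * edges₀ n
degree-sum-balanced zero    = refl
degree-sum-balanced (suc n) = begin
  ∑[ j < n ] count (toℕ j <ᵇ k) + ∑[ i < n ] (count (toℕ i <ᵇ k) + degree (balanced n) i)
    ≡⟨ cong₂ _+_ (∑-below (new-degree≤ n)) (∑-distrib-+ (λ i → count (toℕ i <ᵇ k)) (degree (balanced n))) ⟩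
  k + (∑[ i < n ] count (toℕ i <ᵇ k) + ∑[ i < n ] degree (balanced n) i)
    ≡⟨ cong₂ (λ x y → k + (x + y)) (∑-below (new-degree≤ n)) (degree-sum-balanced n) ⟩
  k + (k + 2 * edges₀ n)
    ≡⟨ double k (edges₀ n) ⟩
  2 * (k + edges₀ n) ∎
  where
  open ≡-Reasoning
  k = new-degree n
  double : ∀ k e → k + (k + 2 * e) ≡ 2 * (k + e)
  double = solve-∀

edgeCount-balanced : ∀ n → edgeCount (balanced n) ≡ edges₀ n
edgeCount-balanced n = *-cancelˡ-≡ _ _ 2 (trans (handshake (balanced n)) (degree-sum-balanced n))

balanced-many-edges : ∀ n → n * n ≤ 4 * edgeCount (balanced n) + n + 2
balanced-many-edges n rewrite edgeCount-balanced n = begin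
  n * n                          ≡⟨ edges₀-invariant n ⟨
  4 * edges₀ n + defect n + n    ≡⟨ +-assoc (4 * edges₀ n) (defect n) n ⟩
  4 * edges₀ n + (defect n + n)  ≡⟨ cong (4 * edges₀ n +_) (+-comm (defect n) n) ⟩
  4 * edges₀ n + (n + defect n)  ≡⟨ +-assoc (4 * edges₀ n) n (defect n) ⟨
  4 * edges₀ n + n + defect n    ≤⟨ +-monoʳ-≤ (4 * edges₀ n + n) (defect≤2 n) ⟩
  4 * edges₀ n + n + 2           ∎
  where open ≤-Reasoning

co-edges-invariant : ∀ n → n * n + defect n ≡ 4 * edgeCount (complement (balanced n)) + n
co-edges-invariant n = +-cancelˡ-≡ (4 * E + n) _ _ (begin
  4 * E + n + (n * n + d)              ≡⟨ regroup E n (n * n) d ⟩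
  n * n + (4 * E + d + n)              ≡⟨ cong (n * n +_) E-invariant ⟩
  n * n + n * n                        ≡⟨ cong₂ _+_ (edgeCount-complete n) (edgeCount-complete n) ⟨
  2 * M + n + (2 * M + n)              ≡⟨ cong (λ m → 2 * m + n + (2 * m + n)) (edgeCount-complement (balanced n)) ⟨
  2 * (E + C) + n + (2 * (E + C) + n)  ≡⟨ regroup′ E C n ⟩
  4 * E + n + (4 * C + n)              ∎)
  where
  open ≡-Reasoning
  E = edgeCount (balanced n)
  C = edgeCount (complement (balanced n))
  M = edgeCount (complete n)
  d = defect n
  E-invariant : 4 * E + d + n ≡ n * n
  E-invariant = trans (cong (λ e → 4 * e + d + n) (edgeCount-balanced n)) (edges₀-invariant n)
  regroup : ∀ E n N d → 4 * E + n + (N + d) ≡ N + (4 * E + d + n)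
  regroup = solve-∀
  regroup′ : ∀ E C n → 2 * (E + C) + n + (2 * (E + C) + n) ≡ 4 * E + n + (4 * C + n)
  regroup′ = solve-∀

balanced-many-non-edges : ∀ n → n * n ≤ 4 * edgeCount (complement (balanced n)) + n + 2
balanced-many-non-edges n = begin
  n * n                                           ≤⟨ m≤m+n (n * n) (defect n) ⟩
  n * n + defect n                                ≡⟨ co-edges-invariant n ⟩
  4 * edgeCount (complement (balanced n)) + n     ≤⟨ m≤m+n _ 2 ⟩
  4 * edgeCount (complement (balanced n)) + n + 2 ∎
  where open ≤-Reasoning

floor-bound : ∀ {n e σ} → n * n ≤ 4 * e + n + 2 → e ≤ σ + n → (n * n ∸ 5 * n) / 4 ≤ σ
floor-bound {n} {e} {σ} many-edges e≤σ+n = s≤s⁻¹ (m<n*o⇒m/o<n (begin-strict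
  n * n ∸ 5 * n  ≤⟨ m≤n+o⇒m∸n≤o (n * n) (5 * n) (begin
                       n * n                ≤⟨ many-edges ⟩
                       4 * e + n + 2        ≤⟨ +-monoˡ-≤ 2 (+-monoˡ-≤ n (*-monoʳ-≤ 4 e≤σ+n)) ⟩
                       4 * (σ + n) + n + 2  ≡⟨ regroup σ n ⟩
                       5 * n + (4 * σ + 2)  ∎) ⟩
  4 * σ + 2      <⟨ +-monoʳ-< (4 * σ) (s≤s (s≤s (s≤s z≤n))) ⟩
  4 * σ + 4      ≡⟨ +-comm (4 * σ) 4 ⟩
  4 + 4 * σ      ≡⟨ cong (4 +_) (*-comm 4 σ) ⟩
  suc σ * 4      ∎))
  where
  open ≤-Reasoning
  regroup : ∀ σ n → 4 * (σ + n) + n + 2 ≡ 5 * n + (4 * σ + 2)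
  regroup = solve-∀

lower-bound : ∀ {n} (H : Graph n) → InQ H → (n * n ∸ 5 * n) / 4 ≤ symDiff (balanced n) H
lower-bound {n} H H∈Q with degree-dichotomy H H∈Q
... | inj₁ Δ≤2  = floor-bound (balanced-many-edges n) (degree≤2⇒edgeCount≤symDiff+n (balanced n) H Δ≤2)
... | inj₂ Δᶜ≤2 = floor-bound (balanced-many-non-edges n)
  (subst (λ σ → edgeCount (complement (balanced n)) ≤ σ + n) (symDiff-complement (balanced n) H)
         (degree≤2⇒edgeCount≤symDiff+n (complement (balanced n)) (complement H) Δᶜ≤2))

InQ-empty : ∀ {n} → InQ (empty n)
InQ-empty (_ , _ , ())

InQ-complete : ∀ {n} → InQ (complete n)
InQ-complete (f , f-injective , three-edges) =
  all-adjacent (edge λ ()) (edge λ ()) (edge λ ()) (edge λ ()) (edge λ ()) (edge λ ()) three-edges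
  where
  edge : ∀ {i j} → i ≢ j → not (does (f i ≟ f j)) ≡ true
  edge {i} {j} i≢j = cong not (dec-false (f i ≟ f j) (i≢j ∘ f-injective))
  all-adjacent : ∀ {b₁ b₂ b₃ b₄ b₅ b₆} →
                 b₁ ≡ true → b₂ ≡ true → b₃ ≡ true → b₄ ≡ true → b₅ ≡ true → b₆ ≡ true →
                 sum (map count (b₁ ∷ b₂ ∷ b₃ ∷ b₄ ∷ b₅ ∷ b₆ ∷ [])) ≢ 3
  all-adjacent refl refl refl refl refl refl ()

smaller≤half-sum : ∀ {a b m} → a ≤ b → a + b ≡ m → 4 * a ≤ 2 * m
smaller≤half-sum {a} {b} {m} a≤b a+b≡m = begin
  4 * a        ≡⟨ regroup a ⟩
  2 * (a + a)  ≤⟨ *-monoʳ-≤ 2 (+-monoʳ-≤ a a≤b) ⟩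
  2 * (a + b)  ≡⟨ cong (2 *_) a+b≡m ⟩
  2 * m        ∎
  where
  open ≤-Reasoning
  regroup : ∀ a → 4 * a ≡ 2 * (a + a)
  regroup = solve-∀

twice-edgeCount-complete : ∀ n → 2 * edgeCount (complete n) ≡ n * n ∸ n
twice-edgeCount-complete n = trans (sym (m+n∸n≡m _ n)) (cong (_∸ n) (edgeCount-complete n))

upper-bound : ∀ {n} (G : Graph n) → Σ (Graph n) λ H → InQ H × (4 * symDiff G H ≤ n * n ∸ n)
upper-bound {n} G with symDiff G (empty n) ≤? symDiff G (complete n)
... | yes e≤c = empty n , InQ-empty ,
  ≤-trans (smaller≤half-sum e≤c (symDiff-empty+complete G)) (≤-reflexive (twice-edgeCount-complete n))
... | no e≰c  = complete n , InQ-complete ,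
  ≤-trans (smaller≤half-sum (<⇒≤ (≰⇒> e≰c)) (trans (+-comm (symDiff G (complete n)) _) (symDiff-empty+complete G)))
          (≤-reflexive (twice-edgeCount-complete n))

theorem5p2 : (n : ℕ) →
    (Σ (Graph n) λ G → (G' : Graph n) → InQ G' → (n * n ∸ 5 * n) / 4 ≤ symDiff G G')
    × ((G : Graph n) → Σ (Graph n) λ G' → InQ G' × (4 * symDiff G G' ≤ n * n ∸ n))
theorem5p2 n = (balanced n , lower-bound) , upper-bound
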